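{- For every integer $m\geq 2$, every finite digraph $D$ is $\frac{2}{m}$-majority $m$-choosable: for any assignment to each vertex $v$ of a list $L(v)$ of $m$ colours, there is a colouring $c$ with $c(v)\in L(v)$ for every vertex $v$, such that for every vertex $v$ the number of out-neighbours $w$ of $v$ with $c(w)=c(v)$ is at most $\frac{2}{m}d^{+}(v)$, where $d^{+}(v)$ is the out-degree of $v$.
   Context: For a real $\alpha\in(0,1]$, an $\alpha$-majority colouring of a digraph is a colouring of its vertices such that each vertex receives the same colour as at most an $\alpha$ proportion of its out-neighbours; a digraph is $\alpha$-majority $m$-choosable if for any assignment of lists of $m$ colours to the vertices there is an $\alpha$-majority colouring in which each vertex gets a colour from its list. -}

module Defs where

open import Data.Nat using (ℕ; _*_; _≤_)
open import Data.Bool using (Bool; true; false; _∧_)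
open import Data.Fin using (Fin)
open import Data.Nat using (_≡ᵇ_)
open import Data.List using (List; length; filter; allFin)
open import Data.List.Membership.Propositional using (_∈_)
open import Data.List.Relation.Unary.Unique.Propositional using (Unique)
open import Relation.Binary.PropositionalEquality using (_≡_)
open import Data.Bool using (T)
open import Relation.Nullary.Decidable using (Dec)
open import Data.Bool.Properties using (T?)

record Digraph : Set where
  field
    n        : ℕ
    arc      : Fin n → Fin n → Bool
    loopless : ∀ v → arc v v ≡ false
open Digraph public

Colour : Set
Colour = ℕ

outNbrs : (D : Digraph) → Fin (n D) → List (Fin (n D))
outNbrs D v = filter (λ w → T? (arc D v w)) (allFin (n D))

outdeg : (D : Digraph) → Fin (n D) → ℕ
outdeg D v = length (outNbrs D v)

sameColourOut : (D : Digraph) → (Fin (n D) → Colour) → Fin (n D) → ℕ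
sameColourOut D c v =
  length (filter (λ w → T? (c w ≡ᵇ c v)) (outNbrs D v))

IsMList : ℕ → List Colour → Set
IsMList m l = (length l ≡ m) × Unique l
  where open import Data.Product using (_×_)

-- (2/m)-majority colouring condition, cleared of denominators:
-- #{w ∈ N⁺(v) : c w = c v} ≤ (2/m) d⁺(v)  ⇔  m · # ≤ 2 · d⁺(v)
TwoOverMMajority : (m : ℕ) (D : Digraph) → (Fin (n D) → Colour) → Set
TwoOverMMajority m D c = ∀ v → m * sameColourOut D c v ≤ 2 * outdeg D v

TwoOverMMajorityChoosable : ℕ → Digraph → Set
TwoOverMMajorityChoosable m D =
  (L : Fin (n D) → List Colour) → (∀ v → IsMList m (L v)) →
  Σ (Fin (n D) → Colour) (λ c → (∀ v → c v ∈ L v) × TwoOverMMajority m D c)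
  where open import Data.Product using (Σ; _×_)

module Submission where

-- Fix a weight x ≥ 0 on the vertices and the potential Σ x u over arcs u → w with c u = c w.
-- Recolouring v from c v to a changes it by cost a − cost (c v), where cost a sums, over the
-- arcs between v and w with c w = a, the weight of their tail. As the colours of L v are
-- distinct, each arc at v is counted for at most one of them, so the costs of the m colours
-- add up to at most x v · d⁺(v) + (weight entering v). When the latter is at most
-- x v · d⁺(v), a vertex v with x v > 0 and m · #same > 2 d⁺(v) has a strictly cheaper
-- colour, and local search ends with every vertex of positive weight satisfied.
--
-- Such weights come from stationary measures of the walk along the arcs inside the set U of
-- vertices still to be handled: there the weight entering v is x v times the out-degree of v
-- into U. One exists on every nonempty U (eliminate the vertices one at a time,
-- Schur-complement style), and its support is closed under arcs within U. If the
-- complement of U is closed under out-arcs, local search leaves it untouched, so it stays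
-- satisfied, and the support can be removed from U. Starting from U = V this resolves
-- every vertex.

open import Defs
open import Data.Bool using (Bool; true; false; T; _∧_)
open import Data.Bool.Properties using (T?; ¬-not) renaming (_≟_ to _≟ᵇ_)
open import Data.Nat
open import Data.Nat.Properties
open import Data.Nat.ListAction using (sum)
open import Data.Nat.Tactic.RingSolver using (solve-∀)
open import Data.Fin using (Fin; zero; suc)
open import Data.Fin.Properties using (any?) renaming (_≟_ to _≟ᶠ_)
open import Data.List using (List; []; _∷_; map; length; filter; tabulate)
open import Data.List.Membership.Propositional using (_∈_)
open import Data.List.Relation.Unary.All using (All; []; _∷_)
open import Data.List.Relation.Unary.Any using (here; there)
open import Data.List.Relation.Unary.AllPairs using ([]; _∷_)
open import Data.List.Relation.Unary.Unique.Propositional using (Unique)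
open import Data.Product using (∃; _×_; _,_; proj₁; proj₂)
open import Data.Vec.Functional using (updateAt) renaming (_∷_ to _∷ᵥ_)
open import Data.Vec.Functional.Properties using (updateAt-updates; updateAt-minimal)
open import Function using (_∘_; const; case_of_)
open import Relation.Binary.PropositionalEquality
open import Relation.Nullary using (yes; no; contradiction)
open import Relation.Nullary.Decidable using (_×-dec_)
open import Algebra.Properties.Semiring.Sum +-*-semiring
  using (sum-syntax; sum-cong-≗; sum-replicate-zero; ∑-distrib-+; *-distribˡ-sum)

-- Indicators and finite sums

𝟙 : Bool → ℕ
𝟙 true  = 1
𝟙 false = 0

𝟙*-≤ : ∀ b y → 𝟙 b * y ≤ y
𝟙*-≤ true  y = ≤-reflexive (*-identityˡ y)
𝟙*-≤ false y = z≤n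

𝟙*-pos⇒true : ∀ b y → 0 < 𝟙 b * y → b ≡ true
𝟙*-pos⇒true true y _ = refl

𝟙-∧-≤ : ∀ a b → 𝟙 (a ∧ b) ≤ 𝟙 a
𝟙-∧-≤ true  true  = ≤-refl
𝟙-∧-≤ true  false = z≤n
𝟙-∧-≤ false b     = z≤n

≡ᵇ-comm : ∀ a b → (a ≡ᵇ b) ≡ (b ≡ᵇ a)
≡ᵇ-comm zero    zero    = refl
≡ᵇ-comm zero    (suc b) = refl
≡ᵇ-comm (suc a) zero    = refl
≡ᵇ-comm (suc a) (suc b) = ≡ᵇ-comm a b

≡ᵇ0-false⇒>0 : ∀ k → (k ≡ᵇ 0) ≡ false → 0 < k
≡ᵇ0-false⇒>0 (suc k) _ = z<s

>0⇒≡ᵇ0-false : ∀ {k} → 0 < k → (k ≡ᵇ 0) ≡ false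
>0⇒≡ᵇ0-false z<s = refl

*-pos⇒left-pos : ∀ a b → 0 < a * b → 0 < a
*-pos⇒left-pos (suc a) b _ = z<s

∑-linear : ∀ {n} a b (f g : Fin n → ℕ) →
  ∑[ i < n ] (a * f i + b * g i) ≡ a * ∑[ i < n ] f i + b * ∑[ i < n ] g i
∑-linear {n} a b f g = begin
  ∑[ i < n ] (a * f i + b * g i)               ≡⟨ ∑-distrib-+ (λ i → a * f i) (λ i → b * g i) ⟩
  ∑[ i < n ] (a * f i) + ∑[ i < n ] (b * g i)  ≡⟨ cong₂ _+_ (*-distribˡ-sum a f) (*-distribˡ-sum b g) ⟨
  a * ∑[ i < n ] f i + b * ∑[ i < n ] g i      ∎
  where open ≡-Reasoning

∑-mono-≤ : ∀ {n} {f g : Fin n → ℕ} → (∀ i → f i ≤ g i) → ∑[ i < n ] f i ≤ ∑[ i < n ] g i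
∑-mono-≤ {zero}  f≤g = z≤n
∑-mono-≤ {suc n} f≤g = +-mono-≤ (f≤g zero) (∑-mono-≤ (f≤g ∘ suc))

∑-mono-< : ∀ {n} {f g : Fin n → ℕ} → (∀ i → f i ≤ g i) → ∀ j → f j < g j →
  ∑[ i < n ] f i < ∑[ i < n ] g i
∑-mono-< f≤g zero    fⱼ<gⱼ = +-mono-<-≤ fⱼ<gⱼ (∑-mono-≤ (f≤g ∘ suc))
∑-mono-< f≤g (suc j) fⱼ<gⱼ = +-mono-≤-< (f≤g zero) (∑-mono-< (f≤g ∘ suc) j fⱼ<gⱼ)

summand≤∑ : ∀ {n} (f : Fin n → ℕ) j → f j ≤ ∑[ i < n ] f i
summand≤∑ f zero    = m≤m+n _ _
summand≤∑ f (suc j) = ≤-trans (summand≤∑ (f ∘ suc) j) (m≤n+m _ _)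

∑-pos⇒summand-pos : ∀ {n} (f : Fin n → ℕ) → 0 < ∑[ i < n ] f i → ∃ λ j → 0 < f j
∑-pos⇒summand-pos {suc n} f ∑>0 with f zero in f₀≡
... | suc _ = zero , subst (0 <_) (sym f₀≡) z<s
... | zero  with ∑-pos⇒summand-pos (f ∘ suc) ∑>0
...   | j , fⱼ>0 = suc j , fⱼ>0

zeroAt : ∀ {n} → Fin n → (Fin n → ℕ) → Fin n → ℕ
zeroAt v f = updateAt f v (const 0)

∑-zeroAt : ∀ {n} (f : Fin n → ℕ) v → ∑[ i < n ] f i ≡ f v + ∑[ i < n ] zeroAt v f i
∑-zeroAt f zero    = refl
∑-zeroAt f (suc v) = begin
  f zero + ∑[ i < _ ] f (suc i)                           ≡⟨ cong (f zero +_) (∑-zeroAt (f ∘ suc) v) ⟩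
  f zero + (f (suc v) + ∑[ i < _ ] zeroAt v (f ∘ suc) i)  ≡⟨ +-comm-middle (f zero) (f (suc v)) _ ⟩
  f (suc v) + (f zero + ∑[ i < _ ] zeroAt v (f ∘ suc) i)  ∎
  where
  open ≡-Reasoning
  +-comm-middle : ∀ a b c → a + (b + c) ≡ b + (a + c)
  +-comm-middle = solve-∀

zeroAt-cong : ∀ {n} v {f g : Fin n → ℕ} → (∀ u → u ≢ v → f u ≡ g u) → ∀ u → zeroAt v f u ≡ zeroAt v g u
zeroAt-cong v {f} {g} f≈g u with u ≟ᶠ v
... | yes refl = trans (updateAt-updates u f) (sym (updateAt-updates u g))
... | no  u≢v  = trans (updateAt-minimal u v f u≢v) (trans (f≈g u u≢v) (sym (updateAt-minimal u v g u≢v)))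

star : ∀ {n} → Fin n → (Fin n → Fin n → ℕ) → ℕ
star {n} v F = ∑[ w < n ] (F v w + F w v)

offStar : ∀ {n} → Fin n → (Fin n → Fin n → ℕ) → ℕ
offStar {n} v F = ∑[ u < n ] zeroAt v (λ u → ∑[ w < n ] zeroAt v (F u) w) u

∑∑-split : ∀ {n} v (F : Fin n → Fin n → ℕ) → F v v ≡ 0 →
  ∑[ u < n ] ∑[ w < n ] F u w ≡ star v F + offStar v F
∑∑-split {n} v F Fᵥᵥ≡0 = begin
  ∑[ u < n ] ∑[ w < n ] F u w            ≡⟨ sum-cong-≗ (λ u → ∑-zeroAt (F u) v) ⟩
  ∑[ u < n ] (F u v + R u)               ≡⟨ ∑-distrib-+ (λ u → F u v) R ⟩
  col + ∑[ u < n ] R u                   ≡⟨ cong (col +_) (∑-zeroAt R v) ⟩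
  col + (R v + offStar v F)              ≡⟨ cong (λ r → col + (r + offStar v F)) row≡Rᵥ ⟨
  col + (row + offStar v F)              ≡⟨ rearrange col row (offStar v F) ⟩
  (row + col) + offStar v F              ≡⟨ cong (_+ offStar v F) (∑-distrib-+ (F v) (λ u → F u v)) ⟨
  star v F + offStar v F                 ∎
  where
  open ≡-Reasoning
  row = ∑[ w < n ] F v w
  col = ∑[ u < n ] F u v
  R : Fin n → ℕ
  R u = ∑[ w < n ] zeroAt v (F u) w
  row≡Rᵥ : row ≡ R v
  row≡Rᵥ = trans (∑-zeroAt (F v) v) (cong (_+ R v) Fᵥᵥ≡0)
  rearrange : ∀ c r o → c + (r + o) ≡ (r + c) + o
  rearrange = solve-∀

∑∑-exchange : ∀ {n} v (F G : Fin n → Fin n → ℕ) → F v v ≡ 0 → G v v ≡ 0 →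
  (∀ u w → u ≢ v → w ≢ v → F u w ≡ G u w) →
  ∑[ u < n ] ∑[ w < n ] F u w + star v G ≡ ∑[ u < n ] ∑[ w < n ] G u w + star v F
∑∑-exchange {n} v F G Fᵥᵥ≡0 Gᵥᵥ≡0 F≈G = begin
  ∑[ u < n ] ∑[ w < n ] F u w + star v G   ≡⟨ cong (_+ star v G) (∑∑-split v F Fᵥᵥ≡0) ⟩
  star v F + offStar v F + star v G        ≡⟨ cong (λ o → star v F + o + star v G) offStar≡ ⟩
  star v F + offStar v G + star v G        ≡⟨ swap (star v F) (star v G) (offStar v G) ⟩
  star v G + offStar v G + star v F        ≡⟨ cong (_+ star v F) (∑∑-split v G Gᵥᵥ≡0) ⟨
  ∑[ u < n ] ∑[ w < n ] G u w + star v F   ∎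
  where
  open ≡-Reasoning
  offStar≡ : offStar v F ≡ offStar v G
  offStar≡ = sum-cong-≗ (zeroAt-cong v λ u u≢v → sum-cong-≗ (zeroAt-cong v λ w w≢v → F≈G u w u≢v w≢v))
  swap : ∀ f g o → f + o + g ≡ g + o + f
  swap = solve-∀

sum-map-∑ : ∀ {A : Set} {n} (F : A → Fin n → ℕ) (l : List A) →
  sum (map (λ a → ∑[ i < n ] F a i) l) ≡ ∑[ i < n ] sum (map (λ a → F a i) l)
sum-map-∑ {n = n} F []      = sym (sum-replicate-zero n)
sum-map-∑         F (a ∷ l) = trans (cong (∑[ i < _ ] F a i +_) (sum-map-∑ F l))
                                    (sym (∑-distrib-+ (F a) λ i → sum (map (λ a → F a i) l)))

sum-map-*ˡ : ∀ {A : Set} k (f : A → ℕ) (l : List A) → sum (map (λ a → k * f a) l) ≡ k * sum (map f l)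
sum-map-*ˡ k f []      = sym (*-zeroʳ k)
sum-map-*ˡ k f (a ∷ l) = trans (cong (k * f a +_) (sum-map-*ˡ k f l)) (sym (*-distribˡ-+ k (f a) _))

occurrences≡0 : ∀ b l → All (b ≢_) l → sum (map (λ a → 𝟙 (b ≡ᵇ a)) l) ≡ 0
occurrences≡0 b []      []          = refl
occurrences≡0 b (a ∷ l) (b≢a ∷ b∉l) with b ≡ᵇ a in b≡ᵇa
... | true  = contradiction (≡ᵇ⇒≡ b a (subst T (sym b≡ᵇa) _)) b≢a
... | false = occurrences≡0 b l b∉l

occurrences≤1 : ∀ b l → Unique l → sum (map (λ a → 𝟙 (b ≡ᵇ a)) l) ≤ 1
occurrences≤1 b []      []        = z≤n
occurrences≤1 b (a ∷ l) (a∉l ∷ u) with b ≡ᵇ a in b≡ᵇa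
... | false = occurrences≤1 b l u
... | true rewrite ≡ᵇ⇒≡ b a (subst T (sym b≡ᵇa) _) | occurrences≡0 a l a∉l = s≤s z≤n

∃-below-average : ∀ {A : Set} (g : A → ℕ) t (l : List A) → sum (map g l) < length l * t →
  ∃ λ a → a ∈ l × g a < t
∃-below-average g t []      ()
∃-below-average g t (a ∷ l) ∑<lt with g a <? t
... | yes gₐ<t = a , here refl , gₐ<t
... | no  gₐ≮t
    with ∃-below-average g t l (+-cancelˡ-< (g a) _ _ (<-≤-trans ∑<lt (+-monoˡ-≤ _ (≮⇒≥ gₐ≮t))))
...   | b , b∈l , g_b<t = b , there b∈l , g_b<t

-- Stationary weights

inflow : ∀ {n} → (Fin n → Fin n → ℕ) → (Fin n → ℕ) → Fin n → ℕ
inflow {n} W x j = ∑[ i < n ] (x i * W i j)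

outflowWithin : ∀ {n} → (Fin n → Fin n → ℕ) → (Fin n → Bool) → Fin n → ℕ
outflowWithin {n} W p j = ∑[ k < n ] (𝟙 (p k) * W j k)

outflowWithin≤rowSum : ∀ {n} (W : Fin n → Fin n → ℕ) p j → outflowWithin W p j ≤ ∑[ k < n ] W j k
outflowWithin≤rowSum W p j = ∑-mono-≤ λ k → 𝟙*-≤ (p k) (W j k)

record StationaryWeight {n} (W : Fin n → Fin n → ℕ) (p : Fin n → Bool) : Set where
  field
    weight    : Fin n → ℕ
    supported : ∀ i → p i ≡ false → weight i ≡ 0
    nonzero   : ∃ λ i → 0 < weight i
    balanced  : ∀ j → p j ≡ true → inflow W weight j ≡ weight j * outflowWithin W p j

module _ {n} (W : Fin (suc n) → Fin (suc n) → ℕ) (p : Fin (suc n) → Bool) where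

  private
    Wₜ : Fin n → Fin n → ℕ
    Wₜ a b = W (suc a) (suc b)

  outflowWithin-skipZero : p zero ≡ false → ∀ j → outflowWithin W p (suc j) ≡ outflowWithin Wₜ (p ∘ suc) j
  outflowWithin-skipZero p₀≡false j rewrite p₀≡false = refl

  stationary-skipZero : p zero ≡ false → StationaryWeight Wₜ (p ∘ suc) → StationaryWeight W p
  stationary-skipZero p₀≡false S = record
    { weight    = 0 ∷ᵥ weight
    ; supported = λ { zero _ → refl ; (suc i) → supported i }
    ; nonzero   = let k , xₖ>0 = nonzero in suc k , xₖ>0
    ; balanced  = balanced′
    }
    where
    open StationaryWeight S
    balanced′ : ∀ j → p j ≡ true → inflow W (0 ∷ᵥ weight) j ≡ (0 ∷ᵥ weight) j * outflowWithin W p j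
    balanced′ zero    p₀≡true = case trans (sym p₀≡false) p₀≡true of λ ()
    balanced′ (suc j) pⱼ      = trans (balanced j pⱼ) (cong (weight j *_) (sym (outflowWithin-skipZero p₀≡false j)))

  outflowFromZero : ℕ
  outflowFromZero = ∑[ k < n ] (𝟙 (p (suc k)) * W zero (suc k))

  stationary-sink : p zero ≡ true → outflowFromZero ≡ 0 → StationaryWeight W p
  stationary-sink p₀≡true r≡0 = record
    { weight    = 1 ∷ᵥ const 0
    ; supported = supported
    ; nonzero   = zero , z<s
    ; balanced  = balanced
    }
    where
    supported : ∀ i → p i ≡ false → (1 ∷ᵥ const 0) i ≡ 0
    supported zero    p₀≡false = case trans (sym p₀≡true) p₀≡false of λ ()
    supported (suc i) _        = refl
    no-exit : ∀ j → p (suc j) ≡ true → 1 * W zero (suc j) ≡ 0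
    no-exit j pⱼ = n≤0⇒n≡0 (subst₂ (λ b r → 𝟙 b * W zero (suc j) ≤ r) pⱼ r≡0
                             (summand≤∑ (λ k → 𝟙 (p (suc k)) * W zero (suc k)) j))
    balanced : ∀ j → p j ≡ true → inflow W (1 ∷ᵥ const 0) j ≡ (1 ∷ᵥ const 0) j * outflowWithin W p j
    balanced zero    _  rewrite sum-replicate-zero n | p₀≡true | r≡0 = sym (*-identityˡ _)
    balanced (suc j) pⱼ rewrite sum-replicate-zero n | no-exit j pⱼ = refl

  private
    r = outflowFromZero

  -- The off-diagonal part of r times the Schur complement of vertex 0 in the Laplacian of W
  -- restricted to p; the factor r keeps it in ℕ.
  schurComplement : Fin n → Fin n → ℕ
  schurComplement a b = r * W (suc a) (suc b) + W (suc a) zero * W zero (suc b)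

  private
    ∑-scaled : ∀ (x : Fin n → ℕ) j → ∑[ i < n ] (r * x i * W (suc i) j) ≡ r * ∑[ i < n ] (x i * W (suc i) j)
    ∑-scaled x j = trans (sum-cong-≗ λ i → *-assoc r (x i) (W (suc i) j))
                         (sym (*-distribˡ-sum r λ i → x i * W (suc i) j))

    schurComplement-inflow : ∀ x b → inflow schurComplement x b
      ≡ r * ∑[ i < n ] (x i * W (suc i) (suc b)) + W zero (suc b) * ∑[ i < n ] (x i * W (suc i) zero)
    schurComplement-inflow x b =
      trans (sum-cong-≗ λ i → expand r (x i) (W (suc i) (suc b)) (W (suc i) zero) (W zero (suc b)))
            (∑-linear r (W zero (suc b)) (λ i → x i * W (suc i) (suc b)) (λ i → x i * W (suc i) zero))
      where
      expand : ∀ r y a c d → y * (r * a + c * d) ≡ r * (y * a) + d * (y * c)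
      expand = solve-∀

    schurComplement-outflow : ∀ b →
      outflowWithin schurComplement (p ∘ suc) b ≡ r * outflowWithin Wₜ (p ∘ suc) b + W (suc b) zero * r
    schurComplement-outflow b =
      trans (sum-cong-≗ λ k → expand r (𝟙 (p (suc k))) (W (suc b) (suc k)) (W (suc b) zero) (W zero (suc k)))
            (∑-linear r (W (suc b) zero) (λ k → 𝟙 (p (suc k)) * W (suc b) (suc k))
                                         (λ k → 𝟙 (p (suc k)) * W zero (suc k)))
      where
      expand : ∀ r y a c d → y * (r * a + c * d) ≡ r * (y * a) + c * (y * d)
      expand = solve-∀

  stationary-eliminateZero : p zero ≡ true → 0 < outflowFromZero →
    StationaryWeight schurComplement (p ∘ suc) → StationaryWeight W p
  stationary-eliminateZero p₀≡true r>0 S′ = record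
    { weight    = X
    ; supported = supported′
    ; nonzero   = let k , xₖ>0 = nonzero in suc k , *-mono-< r>0 xₖ>0
    ; balanced  = balanced′
    }
    where
    open StationaryWeight S′ renaming (weight to x)
    open ≡-Reasoning
    X₀ = ∑[ i < n ] (x i * W (suc i) zero)
    X : Fin (suc n) → ℕ
    X = X₀ ∷ᵥ λ a → r * x a
    supported′ : ∀ i → p i ≡ false → X i ≡ 0
    supported′ zero    p₀≡false = case trans (sym p₀≡true) p₀≡false of λ ()
    supported′ (suc i) pᵢ       = trans (cong (r *_) (supported i pᵢ)) (*-zeroʳ r)
    balanced′ : ∀ j → p j ≡ true → inflow W X j ≡ X j * outflowWithin W p j
    balanced′ zero _ = begin
      X₀ * W zero zero + ∑[ i < n ] (r * x i * W (suc i) zero)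
        ≡⟨ cong (X₀ * W zero zero +_) (∑-scaled x zero) ⟩
      X₀ * W zero zero + r * X₀
        ≡⟨ factor X₀ (W zero zero) r ⟩
      X₀ * (1 * W zero zero + r)
        ≡⟨ cong (λ b → X₀ * (𝟙 b * W zero zero + r)) p₀≡true ⟨
      X₀ * outflowWithin W p zero
        ∎
      where
      factor : ∀ y a c → y * a + c * y ≡ y * (1 * a + c)
      factor = solve-∀
    balanced′ (suc b) p_b = begin
      X₀ * W zero (suc b) + ∑[ i < n ] (r * x i * W (suc i) (suc b))
        ≡⟨ cong (X₀ * W zero (suc b) +_) (∑-scaled x (suc b)) ⟩
      X₀ * W zero (suc b) + r * Σ
        ≡⟨ swap X₀ (W zero (suc b)) (r * Σ) ⟩
      r * Σ + W zero (suc b) * X₀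
        ≡⟨ schurComplement-inflow x b ⟨
      inflow schurComplement x b
        ≡⟨ balanced b p_b ⟩
      x b * outflowWithin schurComplement (p ∘ suc) b
        ≡⟨ cong (x b *_) (schurComplement-outflow b) ⟩
      x b * (r * S + W (suc b) zero * r)
        ≡⟨ factor r (x b) S (W (suc b) zero) ⟩
      r * x b * (1 * W (suc b) zero + S)
        ≡⟨ cong (λ c → r * x b * (𝟙 c * W (suc b) zero + S)) p₀≡true ⟨
      X (suc b) * outflowWithin W p (suc b)
        ∎
      where
      Σ = ∑[ i < n ] (x i * W (suc i) (suc b))
      S = outflowWithin Wₜ (p ∘ suc) b
      swap : ∀ y a c → y * a + c ≡ c + a * y
      swap = solve-∀
      factor : ∀ r y s a → y * (r * s + a * r) ≡ r * y * (1 * a + s)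
      factor = solve-∀

stationaryWeight : ∀ {n} (W : Fin n → Fin n → ℕ) (p : Fin n → Bool) → (∃ λ i → p i ≡ true) →
  StationaryWeight W p
stationaryWeight {suc n} W p (i , pᵢ) with p zero in p₀
... | false = stationary-skipZero W p p₀ (stationaryWeight _ (p ∘ suc) (tailWitness i pᵢ))
  where
  tailWitness : ∀ i → p i ≡ true → ∃ λ i → p (suc i) ≡ true
  tailWitness zero    p₀≡true = case trans (sym p₀) p₀≡true of λ ()
  tailWitness (suc i) pᵢ      = i , pᵢ
... | true with outflowFromZero W p ≟ 0
...   | yes r≡0 = stationary-sink W p p₀ r≡0
...   | no  r≢0 with ∑-pos⇒summand-pos (λ k → 𝟙 (p (suc k)) * W zero (suc k)) (n≢0⇒n>0 r≢0)
...     | k , kᵗʰ>0 = stationary-eliminateZero W p p₀ (n≢0⇒n>0 r≢0)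
                        (stationaryWeight (schurComplement W p) (p ∘ suc) (k , 𝟙*-pos⇒true (p (suc k)) _ kᵗʰ>0))

-- Digraphs and the majority condition

length-filter-tabulate : ∀ {A : Set} {n} (P : A → Bool) (f : Fin n → A) →
  length (filter (λ a → T? (P a)) (tabulate f)) ≡ ∑[ i < n ] 𝟙 (P (f i))
length-filter-tabulate {n = zero}  P f = refl
length-filter-tabulate {n = suc n} P f with P (f zero)
... | true  = cong suc (length-filter-tabulate P (f ∘ suc))
... | false = length-filter-tabulate P (f ∘ suc)

length-filter²-tabulate : ∀ {A : Set} {n} (P Q : A → Bool) (f : Fin n → A) →
  length (filter (λ a → T? (Q a)) (filter (λ a → T? (P a)) (tabulate f)))
    ≡ ∑[ i < n ] (𝟙 (P (f i)) * 𝟙 (Q (f i)))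
length-filter²-tabulate {n = zero}  P Q f = refl
length-filter²-tabulate {n = suc n} P Q f with P (f zero)
... | false = length-filter²-tabulate P Q (f ∘ suc)
... | true with Q (f zero)
...   | true  = cong suc (length-filter²-tabulate P Q (f ∘ suc))
...   | false = length-filter²-tabulate P Q (f ∘ suc)

module _ (D : Digraph) where

  adj : Fin (n D) → Fin (n D) → ℕ
  adj u w = 𝟙 (arc D u w)

  adj-loopless : ∀ v → adj v v ≡ 0
  adj-loopless v rewrite loopless D v = refl

  deg : Fin (n D) → ℕ
  deg v = ∑[ w < n D ] adj v w

  sameColour : (Fin (n D) → Colour) → Fin (n D) → ℕ
  sameColour c v = ∑[ w < n D ] (adj v w * 𝟙 (c w ≡ᵇ c v))

  MajorityAt : ℕ → (Fin (n D) → Colour) → Fin (n D) → Set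
  MajorityAt m c v = m * sameColour c v ≤ 2 * deg v

  outdeg≡deg : ∀ v → outdeg D v ≡ deg v
  outdeg≡deg v = length-filter-tabulate (arc D v) (λ w → w)

  sameColourOut≡sameColour : ∀ c v → sameColourOut D c v ≡ sameColour c v
  sameColourOut≡sameColour c v = length-filter²-tabulate (arc D v) (λ w → c w ≡ᵇ c v) (λ w → w)

  majorityAt⇒TwoOverMMajority : ∀ m c → (∀ v → MajorityAt m c v) → TwoOverMMajority m D c
  majorityAt⇒TwoOverMMajority m c majority v =
    subst₂ (λ s d → m * s ≤ 2 * d) (sym (sameColourOut≡sameColour c v)) (sym (outdeg≡deg v)) (majority v)

  sameColour-local : ∀ {c c′} v → c′ v ≡ c v → (∀ w → arc D v w ≡ true → c′ w ≡ c w) →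
    sameColour c′ v ≡ sameColour c v
  sameColour-local {c} {c′} v c′ᵥ≡cᵥ c′≈c = sum-cong-≗ pointwise
    where
    pointwise : ∀ w → adj v w * 𝟙 (c′ w ≡ᵇ c′ v) ≡ adj v w * 𝟙 (c w ≡ᵇ c v)
    pointwise w with arc D v w in arcᵥw
    ... | true  rewrite c′≈c w arcᵥw | c′ᵥ≡cᵥ = refl
    ... | false = refl

  inflow-pos : ∀ (x : Fin (n D) → ℕ) {v w} → 0 < x v → arc D v w ≡ true → 0 < inflow adj x w
  inflow-pos x {v} {w} xᵥ>0 arcᵥw = <-≤-trans xᵥ>0 (begin
    x v               ≡⟨ *-identityʳ (x v) ⟨
    x v * 1           ≡⟨ cong (λ b → x v * 𝟙 b) arcᵥw ⟨
    x v * adj v w     ≤⟨ summand≤∑ (λ u → x u * adj u w) v ⟩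
    inflow adj x w    ∎)
    where open ≤-Reasoning

-- The recolouring potential

recolour : ∀ {n} → (Fin n → Colour) → Fin n → Colour → Fin n → Colour
recolour c v a = updateAt c v (const a)

FromLists : ∀ {n} → (Fin n → List Colour) → (Fin n → Colour) → Set
FromLists L c = ∀ v → c v ∈ L v

recolour-fromLists : ∀ {n} {L : Fin n → List Colour} {c} v {a} → a ∈ L v → FromLists L c →
  FromLists L (recolour c v a)
recolour-fromLists {c = c} v a∈Lᵥ c∈L w with w ≟ᶠ v
... | yes refl = subst (_∈ _) (sym (updateAt-updates w c)) a∈Lᵥ
... | no  w≢v  = subst (_∈ _) (sym (updateAt-minimal w v c w≢v)) (c∈L w)

module Potential (D : Digraph) (x : Fin (n D) → ℕ) where

  private
    N = n D
    A = adj D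

  monochromatic : (Fin N → Colour) → Fin N → Fin N → ℕ
  monochromatic c u w = x u * A u w * 𝟙 (c w ≡ᵇ c u)

  potential : (Fin N → Colour) → ℕ
  potential c = ∑[ u < N ] ∑[ w < N ] monochromatic c u w

  pairWeight : Fin N → Fin N → ℕ
  pairWeight v w = x v * A v w + x w * A w v

  recolourCost : (Fin N → Colour) → Fin N → Colour → ℕ
  recolourCost c v a = ∑[ w < N ] (pairWeight v w * 𝟙 (c w ≡ᵇ a))

  monochromatic-diag : ∀ c v → monochromatic c v v ≡ 0
  monochromatic-diag c v rewrite adj-loopless D v | *-zeroʳ (x v) = refl

  pairWeight-diag : ∀ v → pairWeight v v ≡ 0
  pairWeight-diag v rewrite adj-loopless D v | *-zeroʳ (x v) = refl

  star-monochromatic : ∀ c v → star v (monochromatic c) ≡ recolourCost c v (c v)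
  star-monochromatic c v = sum-cong-≗ λ w → begin
    x v * A v w * 𝟙 (c w ≡ᵇ c v) + x w * A w v * 𝟙 (c v ≡ᵇ c w)
      ≡⟨ cong (λ b → x v * A v w * 𝟙 (c w ≡ᵇ c v) + x w * A w v * 𝟙 b) (≡ᵇ-comm (c v) (c w)) ⟩
    x v * A v w * 𝟙 (c w ≡ᵇ c v) + x w * A w v * 𝟙 (c w ≡ᵇ c v)
      ≡⟨ *-distribʳ-+ (𝟙 (c w ≡ᵇ c v)) (x v * A v w) (x w * A w v) ⟨
    pairWeight v w * 𝟙 (c w ≡ᵇ c v)
      ∎
    where open ≡-Reasoning

  recolourCost-local : ∀ {c c′} v a → (∀ w → w ≢ v → c′ w ≡ c w) → recolourCost c′ v a ≡ recolourCost c v a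
  recolourCost-local {c} {c′} v a c′≈c = sum-cong-≗ pointwise
    where
    pointwise : ∀ w → pairWeight v w * 𝟙 (c′ w ≡ᵇ a) ≡ pairWeight v w * 𝟙 (c w ≡ᵇ a)
    pointwise w with w ≟ᶠ v
    ... | yes refl rewrite pairWeight-diag w = refl
    ... | no  w≢v  rewrite c′≈c w w≢v = refl

  potential-recolour : ∀ c v a →
    potential (recolour c v a) + recolourCost c v (c v) ≡ potential c + recolourCost c v a
  potential-recolour c v a = begin
    potential c′ + recolourCost c v (c v)    ≡⟨ cong (potential c′ +_) (star-monochromatic c v) ⟨
    potential c′ + star v (monochromatic c)  ≡⟨ ∑∑-exchange v (monochromatic c′) (monochromatic c)
                                                  (monochromatic-diag c′ v) (monochromatic-diag c v) off-v ⟩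
    potential c + star v (monochromatic c′)  ≡⟨ cong (potential c +_) (star-monochromatic c′ v) ⟩
    potential c + recolourCost c′ v (c′ v)   ≡⟨ cong (λ b → potential c + recolourCost c′ v b) (updateAt-updates v c) ⟩
    potential c + recolourCost c′ v a        ≡⟨ cong (potential c +_) (recolourCost-local v a λ w → updateAt-minimal w v c) ⟩
    potential c + recolourCost c v a         ∎
    where
    open ≡-Reasoning
    c′ = recolour c v a
    off-v : ∀ u w → u ≢ v → w ≢ v → monochromatic c′ u w ≡ monochromatic c u w
    off-v u w u≢v w≢v =
      cong₂ (λ s t → x u * A u w * 𝟙 (s ≡ᵇ t)) (updateAt-minimal w v c w≢v) (updateAt-minimal u v c u≢v)

  potential-recolour-< : ∀ c v a → recolourCost c v a < recolourCost c v (c v) →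
    potential (recolour c v a) < potential c
  potential-recolour-< c v a cheaper = +-cancelʳ-< (recolourCost c v (c v)) (potential (recolour c v a)) (potential c)
    (subst (_< potential c + recolourCost c v (c v)) (sym (potential-recolour c v a)) (+-monoʳ-< (potential c) cheaper))

  recolourCost-current : ∀ c v → x v * sameColour D c v ≤ recolourCost c v (c v)
  recolourCost-current c v = begin
    x v * sameColour D c v                        ≡⟨ *-distribˡ-sum (x v) (λ w → A v w * 𝟙 (c w ≡ᵇ c v)) ⟩
    ∑[ w < N ] (x v * (A v w * 𝟙 (c w ≡ᵇ c v)))  ≤⟨ ∑-mono-≤ pointwise ⟩
    recolourCost c v (c v)                        ∎
    where
    open ≤-Reasoning
    pointwise : ∀ w → x v * (A v w * 𝟙 (c w ≡ᵇ c v)) ≤ pairWeight v w * 𝟙 (c w ≡ᵇ c v)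
    pointwise w rewrite sym (*-assoc (x v) (A v w) (𝟙 (c w ≡ᵇ c v))) =
      *-monoˡ-≤ (𝟙 (c w ≡ᵇ c v)) (m≤m+n (x v * A v w) (x w * A w v))

  ∑-recolourCost : ∀ c v l → Unique l → sum (map (recolourCost c v) l) ≤ x v * deg D v + inflow A x v
  ∑-recolourCost c v l unique = begin
    sum (map (recolourCost c v) l)
      ≡⟨ sum-map-∑ (λ a w → pairWeight v w * 𝟙 (c w ≡ᵇ a)) l ⟩
    ∑[ w < N ] sum (map (λ a → pairWeight v w * 𝟙 (c w ≡ᵇ a)) l)
      ≡⟨ sum-cong-≗ (λ w → sum-map-*ˡ (pairWeight v w) (λ a → 𝟙 (c w ≡ᵇ a)) l) ⟩
    ∑[ w < N ] (pairWeight v w * sum (map (λ a → 𝟙 (c w ≡ᵇ a)) l))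
      ≤⟨ ∑-mono-≤ (λ w → *-monoʳ-≤ (pairWeight v w) (occurrences≤1 (c w) l unique)) ⟩
    ∑[ w < N ] (pairWeight v w * 1)
      ≡⟨ sum-cong-≗ (λ w → *-identityʳ (pairWeight v w)) ⟩
    ∑[ w < N ] pairWeight v w
      ≡⟨ ∑-distrib-+ (λ w → x v * A v w) (λ w → x w * A w v) ⟩
    ∑[ w < N ] (x v * A v w) + inflow A x v
      ≡⟨ cong (_+ inflow A x v) (*-distribˡ-sum (x v) (A v)) ⟨
    x v * deg D v + inflow A x v
      ∎
    where open ≤-Reasoning

-- Local search

module _ (D : Digraph) {m} (L : Fin (n D) → List Colour) (lists : ∀ v → IsMList m (L v))
         (x : Fin (n D) → ℕ) (inflow≤ : ∀ v → 0 < x v → inflow (adj D) x v ≤ x v * deg D v) where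

  open Potential D x

  improvingColour : ∀ c v → 0 < x v → 2 * deg D v < m * sameColour D c v →
    ∃ λ a → a ∈ L v × recolourCost c v a < recolourCost c v (c v)
  improvingColour c v xᵥ>0 bad = ∃-below-average (recolourCost c v) (recolourCost c v (c v)) (L v) (begin-strict
    sum (map (recolourCost c v) (L v))     ≤⟨ ∑-recolourCost c v (L v) (proj₂ (lists v)) ⟩
    x v * deg D v + inflow (adj D) x v     ≤⟨ +-monoʳ-≤ (x v * deg D v) (inflow≤ v xᵥ>0) ⟩
    x v * deg D v + x v * deg D v          ≡⟨ double (x v) (deg D v) ⟩
    x v * (2 * deg D v)                    <⟨ *-monoʳ-< (x v) {{>-nonZero xᵥ>0}} bad ⟩
    x v * (m * sameColour D c v)           ≡⟨ swap (x v) m (sameColour D c v) ⟩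
    m * (x v * sameColour D c v)           ≤⟨ *-monoʳ-≤ m (recolourCost-current c v) ⟩
    m * recolourCost c v (c v)             ≡⟨ cong (_* recolourCost c v (c v)) (proj₁ (lists v)) ⟨
    length (L v) * recolourCost c v (c v)  ∎)
    where
    open ≤-Reasoning
    double : ∀ a b → a * b + a * b ≡ a * (2 * b)
    double = solve-∀
    swap : ∀ a b c → a * (b * c) ≡ b * (a * c)
    swap = solve-∀

  record Repair (c : Fin (n D) → Colour) : Set where
    field
      repaired            : Fin (n D) → Colour
      repaired-fromLists  : FromLists L repaired
      unchangedOffSupport : ∀ v → x v ≡ 0 → repaired v ≡ c v
      majorityOnSupport   : ∀ v → 0 < x v → MajorityAt D m repaired v

  localSearch : ∀ c → FromLists L c → Repair c
  localSearch c = descend (suc (potential c)) c ≤-refl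
    where
    descend : ∀ bound c → potential c < bound → FromLists L c → Repair c
    descend (suc bound) c pot<bound c∈L with any? (λ v → (0 <? x v) ×-dec (2 * deg D v <? m * sameColour D c v))
    ... | no noBad = record
      { repaired            = c
      ; repaired-fromLists  = c∈L
      ; unchangedOffSupport = λ _ _ → refl
      ; majorityOnSupport   = λ v xᵥ>0 → ≮⇒≥ λ bad → noBad (v , xᵥ>0 , bad)
      }
    ... | yes (v , xᵥ>0 , bad) with improvingColour c v xᵥ>0 bad
    ...   | a , a∈Lᵥ , cheaper = record
      { repaired            = repaired
      ; repaired-fromLists  = repaired-fromLists
      ; unchangedOffSupport = unchanged
      ; majorityOnSupport   = majorityOnSupport
      }
      where
      open Repair (descend bound (recolour c v a) (<-≤-trans (potential-recolour-< c v a cheaper) (s≤s⁻¹ pot<bound))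
                           (recolour-fromLists v a∈Lᵥ c∈L))
      unchanged : ∀ w → x w ≡ 0 → repaired w ≡ c w
      unchanged w x_w≡0 =
        trans (unchangedOffSupport w x_w≡0) (updateAt-minimal w v c λ { refl → n>0⇒n≢0 xᵥ>0 x_w≡0 })

-- Resolving the vertices

module _ (D : Digraph) {m} (L : Fin (n D) → List Colour) (lists : ∀ v → IsMList m (L v)) where

  record PartialColouring : Set where
    field
      unresolved      : Fin (n D) → Bool
      colouring       : Fin (n D) → Colour
      fromLists       : FromLists L colouring
      closed          : ∀ v w → unresolved v ≡ false → arc D v w ≡ true → unresolved w ≡ false
      majorityOutside : ∀ v → unresolved v ≡ false → MajorityAt D m colouring v

  open PartialColouring

  unresolvedCount : PartialColouring → ℕ
  unresolvedCount P = ∑[ v < n D ] 𝟙 (unresolved P v)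

  module Refinement (P : PartialColouring) (hasUnresolved : ∃ λ k → unresolved P k ≡ true) where

    private
      U = unresolved P

    open StationaryWeight (stationaryWeight (adj D) U hasUnresolved) renaming (weight to x)

    positive⇒unresolved : ∀ v → 0 < x v → U v ≡ true
    positive⇒unresolved v xᵥ>0 with U v in Uᵥ
    ... | true  = refl
    ... | false = contradiction (supported v Uᵥ) (n>0⇒n≢0 xᵥ>0)

    inflow≤ : ∀ v → 0 < x v → inflow (adj D) x v ≤ x v * deg D v
    inflow≤ v xᵥ>0 = begin
      inflow (adj D) x v               ≡⟨ balanced v (positive⇒unresolved v xᵥ>0) ⟩
      x v * outflowWithin (adj D) U v  ≤⟨ *-monoʳ-≤ (x v) (outflowWithin≤rowSum (adj D) U v) ⟩
      x v * deg D v                    ∎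
      where open ≤-Reasoning

    open Repair (localSearch D L lists x inflow≤ (colouring P) (fromLists P))

    U′ : Fin (n D) → Bool
    U′ v = U v ∧ (x v ≡ᵇ 0)

    closed′ : ∀ v w → U′ v ≡ false → arc D v w ≡ true → U′ w ≡ false
    closed′ v w U′ᵥ arcᵥw with U v in Uᵥ
    ... | false rewrite closed P v w Uᵥ arcᵥw = refl
    ... | true with U w in U_w
    ...   | false = refl
    ...   | true  = >0⇒≡ᵇ0-false (*-pos⇒left-pos (x w) _
                      (subst (0 <_) (balanced w U_w) (inflow-pos D x (≡ᵇ0-false⇒>0 (x v) U′ᵥ) arcᵥw)))

    majority′ : ∀ v → U′ v ≡ false → MajorityAt D m repaired v
    majority′ v U′ᵥ with U v in Uᵥ
    ... | true  = majorityOnSupport v (≡ᵇ0-false⇒>0 (x v) U′ᵥ)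
    ... | false = subst (λ s → m * s ≤ 2 * deg D v) (sym sameColour≡) (majorityOutside P v Uᵥ)
      where
      sameColour≡ = sameColour-local D v (unchangedOffSupport v (supported v Uᵥ))
                      λ w arcᵥw → unchangedOffSupport w (supported w (closed P v w Uᵥ arcᵥw))

    refined : PartialColouring
    refined = record
      { unresolved      = U′
      ; colouring       = repaired
      ; fromLists       = repaired-fromLists
      ; closed          = closed′
      ; majorityOutside = majority′
      }

    refined-shrinks : unresolvedCount refined < unresolvedCount P
    refined-shrinks with nonzero
    ... | k , xₖ>0 = ∑-mono-< (λ v → 𝟙-∧-≤ (U v) (x v ≡ᵇ 0)) k resolvedₖ
      where
      resolvedₖ : 𝟙 (U′ k) < 𝟙 (U k)
      resolvedₖ rewrite positive⇒unresolved k xₖ>0 | >0⇒≡ᵇ0-false xₖ>0 = z<s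

  resolve : ∀ bound (P : PartialColouring) → unresolvedCount P < bound →
    ∃ λ c → FromLists L c × ∀ v → MajorityAt D m c v
  resolve (suc bound) P count<bound with any? (λ v → unresolved P v ≟ᵇ true)
  ... | yes hasUnresolved = resolve bound (Refinement.refined P hasUnresolved)
                              (<-≤-trans (Refinement.refined-shrinks P hasUnresolved) (s≤s⁻¹ count<bound))
  ... | no  noneUnresolved = colouring P , fromLists P ,
                             λ v → majorityOutside P v (¬-not λ Uᵥ → noneUnresolved (v , Uᵥ))

  initial : 0 < m → PartialColouring
  initial m>0 = record
    { unresolved      = λ _ → true
    ; colouring       = λ v → proj₁ (first v)
    ; fromLists       = λ v → proj₂ (first v)
    ; closed          = λ _ _ ()
    ; majorityOutside = λ _ ()
    }
    where
    first : ∀ v → ∃ λ a → a ∈ L v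
    first v with L v | lists v
    ... | a ∷ _ | _          = a , here refl
    ... | []    | (refl , _) = contradiction m>0 (<-irrefl refl)

majorityChoosable : ∀ {m} → 0 < m → (D : Digraph) → TwoOverMMajorityChoosable m D
majorityChoosable {m} m>0 D L lists =
  let P₀ = initial D L lists m>0
      c , c∈L , majority = resolve D L lists (suc (unresolvedCount D L lists P₀)) P₀ ≤-refl
  in c , c∈L , majorityAt⇒TwoOverMMajority D m c majority

corollary1 : (m : ℕ) → m ≥ 2 → (D : Digraph) → TwoOverMMajorityChoosable m D
corollary1 m m≥2 = majorityChoosable (<-≤-trans z<s m≥2)
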